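{- Let $L_0$ and $L_1$ be normal modal logics. If $L_0\subseteq L_1=L_0^\star$ and $L_0$ enjoys the uniform Lyndon interpolation property, then $L_1$ also enjoys the uniform Lyndon interpolation property.
   Context: Formulas are built from countably many propositional variables, $\bot$, $\to$, $\Box$. Positive/negative variable sets: $v^+(p)=\{p\}$, $v^-(p)=\emptyset$; $v^\pm(\bot)=\emptyset$; $v^+(\psi\to\theta)=v^-(\psi)\cup v^+(\theta)$, $v^-(\psi\to\theta)=v^+(\psi)\cup v^-(\theta)$; $v^\pm(\Box\psi)=v^\pm(\psi)$. A normal logic is a set of formulas containing all tautologies and $\Box(p\to q)\to(\Box p\to\Box q)$, closed under modus ponens, necessitation and uniform substitution; $L\vdash\varphi$ means $\varphi\in L$. The translation $\star$ is defined by $p^\star=p$, $\bot^\star=\bot$, $(\varphi\to\psi)^\star=\varphi^\star\to\psi^\star$, $(\Box\varphi)^\star=\varphi^\star\land\Box\varphi^\star$; for a normal logic $L$, $L^\star=\{\varphi: L\vdash\varphi^\star\}$. $L$ has the uniform Lyndon interpolation property if for every formula $\varphi$ and finite sets $P,Q$ of variables there is $\theta$ with $v^+(\theta)\subseteq v^+(\varphi)\setminus P$, $v^-(\theta)\subseteq v^-(\varphi)\setminus Q$, $L\vdash\varphi\to\theta$, and $L\vdash\theta\to\psi$ for every $\psi$ with $v^+(\psi)\cap P=v^-(\psi)\cap Q=\emptyset$ and $L\vdash\varphi\to\psi$. -}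

module Defs where

open import Data.Nat using (ℕ)
open import Data.Bool using (Bool; true; false; _∧_; not; _∨_)
open import Data.List using (List; []; _∷_; _++_)
open import Data.List.Membership.Propositional using (_∈_)
open import Data.Product using (Σ; _×_; _,_)
open import Relation.Nullary using (¬_)
open import Relation.Binary.PropositionalEquality using (_≡_)
open import Level using (Level; suc; _⊔_)

data Form : Set where
  var : ℕ → Form
  ⊥'  : Form
  _⇒_ : Form → Form → Form
  □_  : Form → Form

infixr 5 _⇒_
infix 7 □_
infix 8 _⋆

¬' : Form → Form
¬' φ = φ ⇒ ⊥'

_∧'_ : Form → Form → Form
φ ∧' ψ = ¬' (φ ⇒ ¬' ψ)

mutual
  v⁺ : Form → List ℕ
  v⁺ (var p) = p ∷ []
  v⁺ ⊥' = []
  v⁺ (φ ⇒ ψ) = v⁻ φ ++ v⁺ ψ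
  v⁺ (□ φ) = v⁺ φ

  v⁻ : Form → List ℕ
  v⁻ (var p) = []
  v⁻ ⊥' = []
  v⁻ (φ ⇒ ψ) = v⁺ φ ++ v⁻ ψ
  v⁻ (□ φ) = v⁻ φ

-- Tautologies: classical truth, treating variables and boxed formulas as atoms
eval : (ℕ → Bool) → (Form → Bool) → Form → Bool
eval v b (var p) = v p
eval v b ⊥' = false
eval v b (φ ⇒ ψ) = not (eval v b φ) ∨ eval v b ψ
eval v b (□ φ) = b φ

Tautology : Form → Set
Tautology φ = (v : ℕ → Bool) (b : Form → Bool) → eval v b φ ≡ true

subst : (ℕ → Form) → Form → Form
subst σ (var p) = σ p
subst σ ⊥' = ⊥'
subst σ (φ ⇒ ψ) = subst σ φ ⇒ subst σ ψ
subst σ (□ φ) = □ subst σ φ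

-- A logic is a set of formulas (a predicate); L ⊢ φ means φ ∈ L.
Logic : (ℓ : Level) → Set (suc ℓ)
Logic ℓ = Form → Set ℓ

record IsNormal {ℓ} (L : Logic ℓ) : Set ℓ where
  field
    taut : ∀ φ → Tautology φ → L φ
    K    : L (□ (var 0 ⇒ var 1) ⇒ (□ var 0 ⇒ □ var 1))
    mp   : ∀ {φ ψ} → L (φ ⇒ ψ) → L φ → L ψ
    nec  : ∀ {φ} → L φ → L (□ φ)
    usub : ∀ {φ} (σ : ℕ → Form) → L φ → L (subst σ φ)

_⋆ : Form → Form
var p ⋆ = var p
⊥' ⋆ = ⊥'
(φ ⇒ ψ) ⋆ = φ ⋆ ⇒ ψ ⋆
(□ φ) ⋆ = (φ ⋆) ∧' (□ (φ ⋆))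

_^⋆ : ∀ {ℓ} → Logic ℓ → Logic ℓ
(L ^⋆) φ = L (φ ⋆)

_⊆L_ : ∀ {ℓ} → Logic ℓ → Logic ℓ → Set ℓ
L ⊆L M = ∀ φ → L φ → M φ

_≐_ : ∀ {ℓ} → Logic ℓ → Logic ℓ → Set ℓ
L ≐ M = (L ⊆L M) × (M ⊆L L)

_⊆_∖_ : List ℕ → List ℕ → List ℕ → Set
xs ⊆ ys ∖ P = ∀ {p} → p ∈ xs → (p ∈ ys) × (¬ (p ∈ P))

Disjoint : List ℕ → List ℕ → Set
Disjoint xs P = ∀ {p} → p ∈ xs → ¬ (p ∈ P)

ULIP : ∀ {ℓ} → Logic ℓ → Set ℓ
ULIP L = (φ : Form) (P Q : List ℕ) → Σ Form λ θ →
    (v⁺ θ ⊆ v⁺ φ ∖ P) × (v⁻ θ ⊆ v⁻ φ ∖ Q) × L (φ ⇒ θ)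
  × ((ψ : Form) → Disjoint (v⁺ ψ) P → Disjoint (v⁻ ψ) Q → L (φ ⇒ ψ) → L (θ ⇒ ψ))

-- Take as L₁-interpolant of φ the L₀-interpolant θ of φ⋆. Since L₁ ⊇ L₀⋆ contains the
-- schema □A → A (its translation A⋆ ∧ □A⋆ → A⋆ is a tautology), every formula χ is
-- L₁-equivalent to χ⋆; and χ⋆ has the same positive and negative variables as χ.
-- Hence L₁ ⊢ φ → φ⋆ → θ, and if L₁ ⊢ φ → ψ then L₀ ⊢ φ⋆ → ψ⋆, so L₀ ⊢ θ → ψ⋆
-- and L₁ ⊢ θ → ψ⋆ → ψ.
module Submission where

open import Defs
open import Data.Nat using (ℕ; zero; suc)
open import Data.Bool using (true; false)
open import Data.List using (List; _++_)
open import Data.List.Membership.Propositional.Properties using (∈-++⁻)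
open import Data.List.Relation.Binary.Subset.Propositional using (_⊆_)
open import Data.List.Relation.Binary.Subset.Propositional.Properties using (⊆-refl; ++⁺)
open import Data.Product using (_×_; _,_; proj₁; proj₂)
open import Data.Sum using ([_,_]′)
open import Function using (_∘_)
open import Relation.Binary.PropositionalEquality using (refl)

++-⊆ : {xs ys zs : List ℕ} → xs ⊆ zs → ys ⊆ zs → xs ++ ys ⊆ zs
++-⊆ {xs} xs⊆zs ys⊆zs = [ xs⊆zs , ys⊆zs ]′ ∘ ∈-++⁻ xs

mutual
  v⁺-⋆ : ∀ φ → v⁺ (φ ⋆) ⊆ v⁺ φ
  v⁺-⋆ (var p) = ⊆-refl
  v⁺-⋆ ⊥'      = ⊆-refl
  v⁺-⋆ (φ ⇒ ψ) = ++⁺ (v⁻-⋆ φ) (v⁺-⋆ ψ)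
  v⁺-⋆ (□ φ)   = ++-⊆ (++-⊆ (v⁺-⋆ φ) (++-⊆ (v⁺-⋆ φ) λ ())) λ ()

  v⁻-⋆ : ∀ φ → v⁻ (φ ⋆) ⊆ v⁻ φ
  v⁻-⋆ (var p) = ⊆-refl
  v⁻-⋆ ⊥'      = ⊆-refl
  v⁻-⋆ (φ ⇒ ψ) = ++⁺ (v⁺-⋆ φ) (v⁻-⋆ ψ)
  v⁻-⋆ (□ φ)   = ++-⊆ (++-⊆ (v⁻-⋆ φ) (++-⊆ (v⁻-⋆ φ) λ ())) λ ()

⊆∖-mono : {xs ys zs P : List ℕ} → ys ⊆ zs → xs ⊆ ys ∖ P → xs ⊆ zs ∖ P
⊆∖-mono ys⊆zs xs⊆ys∖P p∈xs = ys⊆zs (proj₁ (xs⊆ys∖P p∈xs)) , proj₂ (xs⊆ys∖P p∈xs)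

Disjoint-⊆ : {xs ys P : List ℕ} → xs ⊆ ys → Disjoint ys P → Disjoint xs P
Disjoint-⊆ xs⊆ys ys#P = ys#P ∘ xs⊆ys

⇒-refl-taut : ∀ A → Tautology (A ⇒ A)
⇒-refl-taut A v b with eval v b A
... | true  = refl
... | false = refl

⇒-trans-taut : ∀ A B C → Tautology ((A ⇒ B) ⇒ (B ⇒ C) ⇒ (A ⇒ C))
⇒-trans-taut A B C v b with eval v b A | eval v b B | eval v b C
... | true  | true  | true  = refl
... | true  | true  | false = refl
... | true  | false | _     = refl
... | false | true  | true  = refl
... | false | true  | false = refl
... | false | false | true  = refl
... | false | false | false = refl

⇒-mono-taut : ∀ A A′ B B′ → Tautology ((A′ ⇒ A) ⇒ (B ⇒ B′) ⇒ ((A ⇒ B) ⇒ (A′ ⇒ B′)))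
⇒-mono-taut A A′ B B′ v b with eval v b A | eval v b A′ | eval v b B | eval v b B′
... | true  | true  | true  | true  = refl
... | true  | true  | true  | false = refl
... | true  | true  | false | true  = refl
... | true  | true  | false | false = refl
... | true  | false | true  | true  = refl
... | true  | false | true  | false = refl
... | true  | false | false | true  = refl
... | true  | false | false | false = refl
... | false | true  | _     | _     = refl
... | false | false | true  | true  = refl
... | false | false | true  | false = refl
... | false | false | false | true  = refl
... | false | false | false | false = refl

∧-intro-taut : ∀ A B C → Tautology ((A ⇒ B) ⇒ (A ⇒ C) ⇒ (A ⇒ B ∧' C))
∧-intro-taut A B C v b with eval v b A | eval v b B | eval v b C
... | true  | true  | true  = refl
... | true  | true  | false = refl
... | true  | false | _     = refl
... | false | true  | true  = refl
... | false | true  | false = refl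
... | false | false | true  = refl
... | false | false | false = refl

∧-elimˡ-taut : ∀ A B → Tautology (A ∧' B ⇒ A)
∧-elimˡ-taut A B v b with eval v b A | eval v b B
... | true  | true  = refl
... | true  | false = refl
... | false | true  = refl
... | false | false = refl

∧-elimʳ-taut : ∀ A B → Tautology (A ∧' B ⇒ B)
∧-elimʳ-taut A B v b with eval v b A | eval v b B
... | true  | true  = refl
... | true  | false = refl
... | false | true  = refl
... | false | false = refl

module NormalLogic {ℓ} {L : Logic ℓ} (N : IsNormal L) where
  open IsNormal N

  ⇒-refl : ∀ A → L (A ⇒ A)
  ⇒-refl A = taut _ (⇒-refl-taut A)

  ⇒-trans : ∀ {A B C} → L (A ⇒ B) → L (B ⇒ C) → L (A ⇒ C)
  ⇒-trans {A} {B} {C} A⇒B B⇒C = mp (mp (taut _ (⇒-trans-taut A B C)) A⇒B) B⇒C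

  ⇒-mono : ∀ {A A′ B B′} → L (A′ ⇒ A) → L (B ⇒ B′) → L ((A ⇒ B) ⇒ (A′ ⇒ B′))
  ⇒-mono {A} {A′} {B} {B′} A′⇒A B⇒B′ = mp (mp (taut _ (⇒-mono-taut A A′ B B′)) A′⇒A) B⇒B′

  ∧-intro : ∀ {A B C} → L (A ⇒ B) → L (A ⇒ C) → L (A ⇒ B ∧' C)
  ∧-intro {A} {B} {C} A⇒B A⇒C = mp (mp (taut _ (∧-intro-taut A B C)) A⇒B) A⇒C

  ∧-elimˡ : ∀ A B → L (A ∧' B ⇒ A)
  ∧-elimˡ A B = taut _ (∧-elimˡ-taut A B)

  ∧-elimʳ : ∀ A B → L (A ∧' B ⇒ B)
  ∧-elimʳ A B = taut _ (∧-elimʳ-taut A B)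

  K-instance : ∀ A B → L (□ (A ⇒ B) ⇒ (□ A ⇒ □ B))
  K-instance A B = usub σ K
    where
    σ : ℕ → Form
    σ zero          = A
    σ (suc zero)    = B
    σ (suc (suc _)) = ⊥'

  □-mono : ∀ {A B} → L (A ⇒ B) → L (□ A ⇒ □ B)
  □-mono {A} {B} A⇒B = mp (K-instance A B) (nec A⇒B)

  ⋆-equivalent : (∀ A → L (□ A ⇒ A)) → ∀ χ → L (χ ⇒ χ ⋆) × L (χ ⋆ ⇒ χ)
  ⋆-equivalent T (var p) = ⇒-refl (var p) , ⇒-refl (var p)
  ⋆-equivalent T ⊥'      = ⇒-refl ⊥' , ⇒-refl ⊥'
  ⋆-equivalent T (A ⇒ B) with ⋆-equivalent T A | ⋆-equivalent T B
  ... | A⇒A⋆ , A⋆⇒A | B⇒B⋆ , B⋆⇒B = ⇒-mono A⋆⇒A B⇒B⋆ , ⇒-mono A⇒A⋆ B⋆⇒B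
  ⋆-equivalent T (□ A) with ⋆-equivalent T A
  ... | A⇒A⋆ , A⋆⇒A =
    ∧-intro (⇒-trans (□-mono A⇒A⋆) (T (A ⋆))) (□-mono A⇒A⋆) ,
    ⇒-trans (∧-elimʳ (A ⋆) (□ (A ⋆))) (□-mono A⋆⇒A)

^⋆-T : ∀ {ℓ} {L : Logic ℓ} → IsNormal L → ∀ A → (L ^⋆) (□ A ⇒ A)
^⋆-T N A = NormalLogic.∧-elimˡ N (A ⋆) (□ (A ⋆))

proposition2p10 : ∀ {ℓ} (L₀ L₁ : Logic ℓ) → IsNormal L₀ → IsNormal L₁
    → L₀ ⊆L L₁ → L₁ ≐ (L₀ ^⋆) → ULIP L₀ → ULIP L₁
proposition2p10 L₀ L₁ N₀ N₁ L₀⊆L₁ (L₁⊆L₀⋆ , L₀⋆⊆L₁) ulip φ P Q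
  with ulip (φ ⋆) P Q
... | θ , θ⁺ , θ⁻ , φ⋆⇒θ , θ-uniform =
  θ , ⊆∖-mono (v⁺-⋆ φ) θ⁺ , ⊆∖-mono (v⁻-⋆ φ) θ⁻ ,
  ⇒-trans (proj₁ (⋆-equiv φ)) (L₀⊆L₁ _ φ⋆⇒θ) ,
  λ ψ ψ⁺#P ψ⁻#Q φ⇒ψ →
    let θ⇒ψ⋆ = θ-uniform (ψ ⋆) (Disjoint-⊆ (v⁺-⋆ ψ) ψ⁺#P) (Disjoint-⊆ (v⁻-⋆ ψ) ψ⁻#Q)
                         (L₁⊆L₀⋆ _ φ⇒ψ)
    in ⇒-trans (L₀⊆L₁ _ θ⇒ψ⋆) (proj₂ (⋆-equiv ψ))
  where
  open NormalLogic N₁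
  ⋆-equiv : ∀ χ → L₁ (χ ⇒ χ ⋆) × L₁ (χ ⋆ ⇒ χ)
  ⋆-equiv = ⋆-equivalent (λ A → L₀⋆⊆L₁ _ (^⋆-T N₀ A))
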